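{- Let $n\ge2$ and let $F_1,\dots,F_n$ be finite fields. Then $\kappa(\mathbb{CAY}(F_1\times\cdots\times F_n))\ge|Z(F_1\times\cdots\times F_n)|-1$.
   Context: $Z(S)$ denotes the set of zero-divisors of a ring $S$ (including $0$). $\mathbb{CAY}(S)$ is the graph with vertex set $S$ in which distinct $x,y$ are adjacent iff $x-y\in Z(S)$. $\kappa$ denotes vertex connectivity. -}

module Defs where

open import Level using (Level; _⊔_)
open import Relation.Binary.PropositionalEquality using (_≡_)
open import Data.Nat using (ℕ; zero; suc; _<_; _∸_)
open import Data.Fin using (Fin; zero; suc)
open import Data.Product using (Σ; ∃; ∃-syntax; _×_; _,_)
open import Data.Sum using (_⊎_)
open import Data.List using (List; length)
open import Data.List.Relation.Unary.All using (All)
open import Data.List.Relation.Unary.Any using (Any)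
open import Data.List.Relation.Unary.AllPairs using (AllPairs)
open import Relation.Nullary using (¬_)
open import Relation.Binary.Bundles using (Setoid)
open import Algebra.Bundles using (CommutativeRing)
import Algebra.Construct.DirectProduct as DP

private
  variable
    c ℓ : Level

record IsField (R : CommutativeRing c ℓ) : Set (c ⊔ ℓ) where
  open CommutativeRing R
  field
    1≉0     : ¬ (1# ≈ 0#)
    inverse : ∀ x → ¬ (x ≈ 0#) → ∃[ y ] (x * y ≈ 1#)

IsFinite : Setoid c ℓ → Set (c ⊔ ℓ)
IsFinite S = ∃[ k ] Σ (Fin k → Carrier) (λ e → ∀ x → ∃[ i ] (e i ≈ x))
  where open Setoid S

record FiniteField (c ℓ : Level) : Set (Level.suc (c ⊔ ℓ)) where
  field
    ring    : CommutativeRing c ℓ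
    isField : IsField ring
    finite  : IsFinite (CommutativeRing.setoid ring)

-- Direct product F₀ × (F₁ × (⋯ × Fₙ)) of n+1 commutative rings

Prod : (n : ℕ) → (Fin (suc n) → CommutativeRing c ℓ) → CommutativeRing c ℓ
Prod zero    F = F zero
Prod (suc n) F = DP.commutativeRing (F zero) (Prod n (λ i → F (suc i)))

Z : (R : CommutativeRing c ℓ) → CommutativeRing.Carrier R → Set (c ⊔ ℓ)
Z R x = (x ≈ 0#) ⊎ (∃[ y ] (¬ (y ≈ 0#) × (x * y ≈ 0#)))
  where open CommutativeRing R

record Graph (c ℓ e : Level) : Set (Level.suc (c ⊔ ℓ ⊔ e)) where
  field
    V   : Setoid c ℓ
    Adj : Setoid.Carrier V → Setoid.Carrier V → Set e

CAY : CommutativeRing c ℓ → Graph c ℓ (c ⊔ ℓ)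
CAY R = record
  { V   = setoid
  ; Adj = λ x y → ¬ (x ≈ y) × Z R (x - y)
  }
  where open CommutativeRing R

module _ {c ℓ : Level} (S : Setoid c ℓ) where
  open Setoid S

  _∈ₗ_ : Carrier → List Carrier → Set (c ⊔ ℓ)
  x ∈ₗ xs = Any (x ≈_) xs

  Distinct : List Carrier → Set (c ⊔ ℓ)
  Distinct = AllPairs (λ x y → ¬ (x ≈ y))

  HasSize : {p : Level} → (Carrier → Set p) → ℕ → Set (c ⊔ ℓ ⊔ p)
  HasSize P k = ∃[ xs ] (length xs ≡ k × Distinct xs × All P xs
                         × (∀ x → P x → x ∈ₗ xs))

module _ {c ℓ e : Level} (G : Graph c ℓ e) where
  open Graph G
  open Setoid V

  -- walks in G − S (all vertices after the first avoid S)
  data Walk (S : List Carrier) : Carrier → Carrier → Set (c ⊔ ℓ ⊔ e) where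
    here : ∀ {u v} → u ≈ v → Walk S u v
    step : ∀ {u w v} → Adj u w → ¬ (_∈ₗ_ V w S) → Walk S w v → Walk S u v

  ConnectedWithout : List Carrier → Set (c ⊔ ℓ ⊔ e)
  ConnectedWithout S = ∀ u v → ¬ (_∈ₗ_ V u S) → ¬ (_∈ₗ_ V v S) → Walk S u v

  NontrivialWithout : List Carrier → Set (c ⊔ ℓ)
  NontrivialWithout S =
    ∃[ u ] ∃[ v ] (¬ (_∈ₗ_ V u S) × ¬ (_∈ₗ_ V v S) × ¬ (u ≈ v))

  -- κ(G) ≥ k : removing fewer than k vertices leaves a connected graph
  -- with at least two vertices (κ(G) = min |S| with G − S disconnected
  -- or trivial)
  κ≥ : ℕ → Set (c ⊔ ℓ ⊔ e)
  κ≥ k = ∀ (S : List Carrier) → Distinct V S → length S < k →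
         NontrivialWithout S × ConnectedWithout S

-- Let x ≠ y survive the removal of fewer than |Z| − 1 vertices.  If x − y
-- is a zero-divisor they are adjacent.  Otherwise d = x − y is a unit, and
-- every zero-divisor a ≠ 0 yields a path x, x − a, x − σ(a), y (shortened to
-- x, x − a, y when d − a is a zero-divisor), where σ exchanges 0 and d in
-- every coordinate.  Since σ is injective and its values on zero-divisors
-- have a coordinate equal to that of d, the inner vertices of these |Z|
-- paths are pairwise disjoint, so by pigeonhole one of them avoids the
-- removed vertices and x.  Equality in the product is decidable because
-- every element (a, 0) is a zero-divisor and Z is given as a finite list.
module Submission where

open import Defs
open import Level using (Level; _⊔_)
open import Data.Nat using (ℕ; zero; suc; _∸_; _<_; _≤_; s≤s)
open import Data.Nat.Properties using (<-trans; n<1+n)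
open import Data.Fin using (Fin)
import Data.Fin as Fin
open import Data.Product using (∃; ∃-syntax; _×_; _,_; proj₁; proj₂)
open import Data.Sum using (_⊎_; inj₁; inj₂)
import Data.Sum as Sum
import Data.Product as Product
open import Data.Empty using (⊥; ⊥-elim)
open import Relation.Nullary using (¬_; Dec; yes; no)
open import Relation.Nullary.Decidable using (map′; _×-dec_; _⊎-dec_; ¬?)
open import Relation.Binary.Definitions using (Decidable)
import Relation.Binary.PropositionalEquality as ≡
open import Data.List using (List; _∷_; length)
open import Data.List.Properties using (length-removeAt′)
open import Data.List.Membership.Propositional using (_∈_)
import Data.List.Relation.Unary.All as All
open import Data.List.Relation.Unary.Any using (Any; here; there; any?; _─_)
import Data.List.Relation.Unary.Any as Any
open import Data.List.Relation.Unary.AllPairs using (AllPairs; _∷_)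
import Data.List.Relation.Unary.AllPairs as AllPairs
open import Relation.Binary.Bundles using (Setoid)
open import Algebra.Bundles using (CommutativeRing)
import Algebra.Construct.DirectProduct as DP

private
  variable
    c ℓ : Level

module _ {a p q} {A : Set a} {P : A → Set p} {Q : A → Set q} where

  Any-─ : ∀ {xs} (i : Any Q xs) → Any P xs → (∃ λ x → Q x × P x) ⊎ Any P (xs ─ i)
  Any-─ (here qx) (here px) = inj₁ (_ , qx , px)
  Any-─ (here _)  (there p) = inj₂ p
  Any-─ (there _) (here px) = inj₂ (here px)
  Any-─ (there i) (there p) = Sum.map₂ there (Any-─ i p)

module _ {a b p} {A : Set a} {B : Set b} (H : A → B → Set p) where

  Disjoint : A → A → Set (b ⊔ p)
  Disjoint x x′ = ∀ y → H x y → H x′ y → ⊥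

module _ {a b p} {A : Set a} {B : Set b} (H : A → B → Set p)
         (H? : ∀ x y → Dec (H x y)) where

  pigeonhole : (xs : List A) (ys : List B) → length ys < length xs →
               AllPairs (Disjoint H) xs → ∃[ x ] (x ∈ xs × ¬ Any (H x) ys)
  pigeonhole (x ∷ xs) ys (s≤s |ys|≤|xs|) (x-disjoint ∷ disjoint) with any? (H? x) ys
  ... | no  x-misses = x , here ≡.refl , x-misses
  ... | yes x-hits = extend (pigeonhole xs (ys ─ x-hits) shorter disjoint)
    where
    shorter : length (ys ─ x-hits) < length xs
    shorter = ≡.subst (_≤ length xs) (length-removeAt′ ys (Any.index x-hits)) |ys|≤|xs|

    extend : ∃[ x′ ] (x′ ∈ xs × ¬ Any (H x′) (ys ─ x-hits)) →
             ∃[ x′ ] (x′ ∈ x ∷ xs × ¬ Any (H x′) ys)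
    extend (x′ , x′∈xs , x′-misses) = x′ , there x′∈xs , x′-misses-ys
      where
      x′-misses-ys : ¬ Any (H x′) ys
      x′-misses-ys hit with Any-─ x-hits hit
      ... | inj₁ (y , Hxy , Hx′y) = All.lookup x-disjoint x′∈xs y Hxy Hx′y
      ... | inj₂ hit′             = x′-misses hit′

module _ {a ℓ} (S : Setoid a ℓ) where
  open Setoid S

  ≈-dec-∈ₗ : ∀ {x y xs} → Distinct S xs → _∈ₗ_ S x xs → _∈ₗ_ S y xs → Dec (x ≈ y)
  ≈-dec-∈ₗ _             (here x≈)  (here y≈)  = yes (trans x≈ (sym y≈))
  ≈-dec-∈ₗ (x≉ ∷ _)      (here x≈)  (there y∈) =
    no λ x≈y → let x≉z , y≈z = All.lookupAny x≉ y∈ in x≉z (trans (sym x≈) (trans x≈y y≈z))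
  ≈-dec-∈ₗ (y≉ ∷ _)      (there x∈) (here y≈)  =
    no λ x≈y → let y≉z , x≈z = All.lookupAny y≉ x∈ in y≉z (trans (sym y≈) (trans (sym x≈y) x≈z))
  ≈-dec-∈ₗ (_ ∷ distinct) (there x∈) (there y∈) = ≈-dec-∈ₗ distinct x∈ y∈

  Distinct⇒Disjoint : ∀ {xs} → Distinct S xs → AllPairs (Disjoint _≈_) xs
  Distinct⇒Disjoint = AllPairs.map (λ x≉x′ y x≈y x′≈y → x≉x′ (trans x≈y (sym x′≈y)))

  two-∉ : Decidable _≈_ → ∀ {xs} → Distinct S xs → ∀ ys → suc (length ys) < length xs →
          ∃[ u ] ∃[ v ] (¬ _∈ₗ_ S u ys × ¬ _∈ₗ_ S v ys × ¬ u ≈ v)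
  two-∉ _≟_ {xs} distinct ys |ys|<|xs|
    with u , _ , u∉ys ←
           pigeonhole _≈_ _≟_ xs ys (<-trans (n<1+n _) |ys|<|xs|) (Distinct⇒Disjoint distinct)
    with v , _ , v∉u∷ys ←
           pigeonhole _≈_ _≟_ xs (u ∷ ys) |ys|<|xs| (Distinct⇒Disjoint distinct)
    = u , v , u∉ys , (λ v∈ys → v∉u∷ys (there v∈ys)) , (λ u≈v → v∉u∷ys (here (sym u≈v)))

module SubtractionLemmas (R : CommutativeRing c ℓ) where
  open CommutativeRing R
  open import Algebra.Properties.Ring ring using (-0#≈0#; -‿+-comm; -‿involutive)
  open import Relation.Binary.Reasoning.Setoid setoid

  x-0≈x : ∀ x → x - 0# ≈ x
  x-0≈x x = trans (+-congˡ -0#≈0#) (+-identityʳ x)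

  x-[x-y]≈y : ∀ x y → x - (x - y) ≈ y
  x-[x-y]≈y x y = begin
    x + - (x + - y)     ≈⟨ +-congˡ (-‿+-comm x (- y)) ⟨
    x + (- x + - - y)   ≈⟨ +-assoc x (- x) (- - y) ⟨
    (x + - x) + - - y   ≈⟨ +-congʳ (-‿inverseʳ x) ⟩
    0# + - - y          ≈⟨ +-identityˡ (- - y) ⟩
    - - y               ≈⟨ -‿involutive y ⟩
    y                   ∎

  x-y≈x-z⇒y≈z : ∀ x y z → x - y ≈ x - z → y ≈ z
  x-y≈x-z⇒y≈z x y z e = begin
    y             ≈⟨ x-[x-y]≈y x y ⟨
    x - (x - y)   ≈⟨ +-congˡ (-‿cong e) ⟩
    x - (x - z)   ≈⟨ x-[x-y]≈y x z ⟩
    z             ∎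

  [x-y]-z≈[x-z]-y : ∀ x y z → (x - y) - z ≈ (x - z) - y
  [x-y]-z≈[x-z]-y x y z = begin
    (x + - y) + - z   ≈⟨ +-assoc x (- y) (- z) ⟩
    x + (- y + - z)   ≈⟨ +-congˡ (+-comm (- y) (- z)) ⟩
    x + (- z + - y)   ≈⟨ +-assoc x (- z) (- y) ⟨
    (x + - z) + - y   ∎

  [x-y]-[x-z]≈z-y : ∀ x y z → (x - y) - (x - z) ≈ z - y
  [x-y]-[x-z]≈z-y x y z = trans ([x-y]-z≈[x-z]-y x y (x - z)) (+-congʳ (x-[x-y]≈y x z))

module _ (R : CommutativeRing c ℓ) where
  open CommutativeRing R

  Z-resp-≈ : ∀ {x y} → x ≈ y → Z R x → Z R y
  Z-resp-≈ x≈y (inj₁ x≈0)              = inj₁ (trans (sym x≈y) x≈0)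
  Z-resp-≈ x≈y (inj₂ (w , w≉0 , xw≈0)) = inj₂ (w , w≉0 , trans (*-congʳ (sym x≈y)) xw≈0)

-- swap d exchanges 0 and d coordinatewise: in a field it is the transposition
-- (0 d), and in a product of fields it acts in each factor.
record ZeroSwapping (R : CommutativeRing c ℓ) : Set (c ⊔ ℓ) where
  open CommutativeRing R
  field
    _≟_            : Decidable _≈_
    Z?             : ∀ x → Dec (Z R x)
    1≉0            : ¬ 1# ≈ 0#
    swap           : Carrier → Carrier → Carrier
    swap-injective : ∀ d a b → swap d a ≈ swap d b → a ≈ b
    swap≈d⇒≈0      : ∀ d a → swap d a ≈ d → a ≈ 0#
    Z[a]⇒Z[d-swap]    : ∀ d a → Z R a → Z R (d - swap d a)
    Z[swap]⇒Z[d-a]  : ∀ d a → Z R (swap d a) → Z R (d - a)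
    ¬Z[d-a]⇒Z[swap-a]     : ∀ d a → ¬ Z R (d - a) → ¬ a ≈ 0# → Z R (swap d a - a)

module _ {R : CommutativeRing c ℓ} (F : IsField R) where
  open CommutativeRing R
  open IsField F
  open SubtractionLemmas R using (x-[x-y]≈y)
  open import Algebra.Properties.Ring ring using (x≈y⇒x∙y⁻¹≈ε)
  open import Relation.Binary.Reasoning.Setoid setoid

  field-Z⇒≈0 : ∀ {x} → Z R x → x ≈ 0#
  field-Z⇒≈0 (inj₁ x≈0) = x≈0
  field-Z⇒≈0 {x} (inj₂ (y , y≉0 , xy≈0)) = begin
    x             ≈⟨ *-identityʳ x ⟨
    x * 1#        ≈⟨ *-congˡ (proj₂ (inverse y y≉0)) ⟨
    x * (y * y⁻¹) ≈⟨ *-assoc x y y⁻¹ ⟨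
    (x * y) * y⁻¹ ≈⟨ *-congʳ xy≈0 ⟩
    0# * y⁻¹      ≈⟨ zeroˡ y⁻¹ ⟩
    0#            ∎
    where y⁻¹ = proj₁ (inverse y y≉0)

  module _ (_≟_ : Decidable _≈_) where

    transposition : Carrier → Carrier → Carrier
    transposition d a with a ≟ 0#
    ... | yes _ = d
    ... | no  _ with a ≟ d
    ...   | yes _ = 0#
    ...   | no  _ = a

    transposition-injective : ∀ d a b → transposition d a ≈ transposition d b → a ≈ b
    transposition-injective d a b e with a ≟ 0# | b ≟ 0#
    ... | yes a≈0 | yes b≈0 = trans a≈0 (sym b≈0)
    ... | yes a≈0 | no  b≉0 with b ≟ d
    ...   | yes b≈d = trans a≈0 (trans (sym e) (sym b≈d))
    ...   | no  b≉d = ⊥-elim (b≉d (sym e))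
    transposition-injective d a b e | no a≉0 | yes b≈0 with a ≟ d
    ...   | yes a≈d = trans a≈d (trans (sym e) (sym b≈0))
    ...   | no  a≉d = ⊥-elim (a≉d e)
    transposition-injective d a b e | no a≉0 | no b≉0 with a ≟ d | b ≟ d
    ... | yes a≈d | yes b≈d = trans a≈d (sym b≈d)
    ... | yes _   | no  _   = ⊥-elim (b≉0 (sym e))
    ... | no  _   | yes _   = ⊥-elim (a≉0 e)
    ... | no  _   | no  _   = e

    transposition≈d⇒≈0 : ∀ d a → transposition d a ≈ d → a ≈ 0#
    transposition≈d⇒≈0 d a e with a ≟ 0#
    ... | yes a≈0 = a≈0
    ... | no  _ with a ≟ d
    ...   | yes a≈d = trans a≈d (sym e)
    ...   | no  a≉d = ⊥-elim (a≉d e)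

    ≈0⇒transposition≈d : ∀ d a → a ≈ 0# → transposition d a ≈ d
    ≈0⇒transposition≈d d a a≈0 with a ≟ 0#
    ... | yes _   = refl
    ... | no  a≉0 = ⊥-elim (a≉0 a≈0)

    transposition≈0⇒≈d : ∀ d a → transposition d a ≈ 0# → a ≈ d
    transposition≈0⇒≈d d a e with a ≟ 0#
    ... | yes a≈0 = trans a≈0 (sym e)
    ... | no  a≉0 with a ≟ d
    ...   | yes a≈d = a≈d
    ...   | no  _   = ⊥-elim (a≉0 e)

    transposition-fix : ∀ d a → ¬ a ≈ d → ¬ a ≈ 0# → transposition d a ≈ a
    transposition-fix d a a≉d a≉0 with a ≟ 0#
    ... | yes a≈0 = ⊥-elim (a≉0 a≈0)
    ... | no  _ with a ≟ d
    ...   | yes a≈d = ⊥-elim (a≉d a≈d)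
    ...   | no  _   = refl

    field-zeroSwapping : ZeroSwapping R
    field-zeroSwapping = record
      { _≟_            = _≟_
      ; Z?             = λ x → map′ inj₁ field-Z⇒≈0 (x ≟ 0#)
      ; 1≉0            = 1≉0
      ; swap           = transposition
      ; swap-injective = transposition-injective
      ; swap≈d⇒≈0      = transposition≈d⇒≈0
      ; Z[a]⇒Z[d-swap]    = λ d a Za →
          inj₁ (x≈y⇒x∙y⁻¹≈ε (sym (≈0⇒transposition≈d d a (field-Z⇒≈0 Za))))
      ; Z[swap]⇒Z[d-a]  = λ d a Zσa →
          inj₁ (x≈y⇒x∙y⁻¹≈ε (sym (transposition≈0⇒≈d d a (field-Z⇒≈0 Zσa))))
      ; ¬Z[d-a]⇒Z[swap-a]     = λ d a ¬Z[d-a] a≉0 →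
          inj₁ (x≈y⇒x∙y⁻¹≈ε (transposition-fix d a
                  (λ a≈d → ¬Z[d-a] (inj₁ (x≈y⇒x∙y⁻¹≈ε (sym a≈d)))) a≉0))
      }

module _ (A B : CommutativeRing c ℓ) where
  private
    A×B = DP.commutativeRing A B
    module A = CommutativeRing A
    module B = CommutativeRing B
    open CommutativeRing A×B using (_≈_)

  ≟-proj₁ : Decidable _≈_ → Decidable A._≈_
  ≟-proj₁ _≟_ a a′ = map′ proj₁ (_, B.refl) ((a , B.0#) ≟ (a′ , B.0#))

  ≟-proj₂ : Decidable _≈_ → Decidable B._≈_
  ≟-proj₂ _≟_ b b′ = map′ proj₂ (A.refl ,_) ((A.0# , b) ≟ (A.0# , b′))

  Z-inj₁ : ¬ A.1# A.≈ A.0# → ∀ {a} b → Z A a → Z A×B (a , b)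
  Z-inj₁ 1≉0 {a} b (inj₁ a≈0) =
    inj₂ ((A.1# , B.0#) , (λ e → 1≉0 (proj₁ e)) , A.trans (A.*-identityʳ a) a≈0 , B.zeroʳ b)
  Z-inj₁ _ b (inj₂ (y , y≉0 , ay≈0)) =
    inj₂ ((y , B.0#) , (λ e → y≉0 (proj₁ e)) , ay≈0 , B.zeroʳ b)

  Z-inj₂ : ¬ B.1# B.≈ B.0# → ∀ a {b} → Z B b → Z A×B (a , b)
  Z-inj₂ 1≉0 a {b} (inj₁ b≈0) =
    inj₂ ((A.0# , B.1#) , (λ e → 1≉0 (proj₂ e)) , A.zeroʳ a , B.trans (B.*-identityʳ b) b≈0)
  Z-inj₂ _ a (inj₂ (y , y≉0 , by≈0)) =
    inj₂ ((A.0# , y) , (λ e → y≉0 (proj₂ e)) , A.zeroʳ a , by≈0)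

  Z-proj : Decidable A._≈_ → ∀ {a b} → Z A×B (a , b) → Z A a ⊎ Z B b
  Z-proj _ (inj₁ (a≈0 , _)) = inj₁ (inj₁ a≈0)
  Z-proj _≟_ (inj₂ ((y₁ , y₂) , y≉0 , ay₁≈0 , by₂≈0)) with y₁ ≟ A.0#
  ... | no  y₁≉0 = inj₁ (inj₂ (y₁ , y₁≉0 , ay₁≈0))
  ... | yes y₁≈0 = inj₂ (inj₂ (y₂ , (λ y₂≈0 → y≉0 (y₁≈0 , y₂≈0)) , by₂≈0))

  -- Every element (a, b) with a = 0 or b = 0 is a zero-divisor, so equality
  -- on all of A × B is decided by positions in the list of zero-divisors.
  ≟-from-Z : ¬ A.1# A.≈ A.0# → ¬ B.1# B.≈ B.0# → ∀ {z} →
             HasSize (CommutativeRing.setoid A×B) (Z A×B) z → Decidable _≈_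
  ≟-from-Z A-1≉0 B-1≉0 (xs , _ , distinct , _ , complete) (a , b) (a′ , b′) =
    map′ proj₁ (_, B.refl) (≟-Z (Z-inj₂ B-1≉0 a (inj₁ B.refl)) (Z-inj₂ B-1≉0 a′ (inj₁ B.refl)))
    ×-dec
    map′ proj₂ (A.refl ,_) (≟-Z (Z-inj₁ A-1≉0 b (inj₁ A.refl)) (Z-inj₁ A-1≉0 b′ (inj₁ A.refl)))
    where
    ≟-Z : ∀ {x y} → Z A×B x → Z A×B y → Dec (x ≈ y)
    ≟-Z Zx Zy = ≈-dec-∈ₗ (CommutativeRing.setoid A×B) distinct (complete _ Zx) (complete _ Zy)

module _ {A B : CommutativeRing c ℓ} (σA : ZeroSwapping A) (σB : ZeroSwapping B) where
  private
    A×B = DP.commutativeRing A B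
    module A = CommutativeRing A
    module B = CommutativeRing B
    module σA = ZeroSwapping σA
    module σB = ZeroSwapping σB

  Z-join : ∀ {a b} → Z A a ⊎ Z B b → Z A×B (a , b)
  Z-join {a} {b} = Sum.[ Z-inj₁ A B σA.1≉0 b , Z-inj₂ A B σB.1≉0 a ]

  open CommutativeRing A×B using (Carrier; _≈_; _-_; 0#)

  ×-swap : Carrier → Carrier → Carrier
  ×-swap (d₁ , d₂) (a₁ , a₂) = σA.swap d₁ a₁ , σB.swap d₂ a₂

  ×-¬Z[d-a]⇒Z[swap-a] : ∀ d a → ¬ Z A×B (d - a) → ¬ a ≈ 0# → Z A×B (×-swap d a - a)
  ×-¬Z[d-a]⇒Z[swap-a] (d₁ , d₂) (a₁ , a₂) ¬Z[d-a] a≉0 with a₁ σA.≟ A.0#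
  ... | no  a₁≉0 = Z-join (inj₁ (σA.¬Z[d-a]⇒Z[swap-a] d₁ a₁ (λ Z₁ → ¬Z[d-a] (Z-join (inj₁ Z₁))) a₁≉0))
  ... | yes a₁≈0 = Z-join (inj₂ (σB.¬Z[d-a]⇒Z[swap-a] d₂ a₂ (λ Z₂ → ¬Z[d-a] (Z-join (inj₂ Z₂)))
                                                  (λ a₂≈0 → a≉0 (a₁≈0 , a₂≈0))))

  ×-zeroSwapping : ZeroSwapping A×B
  ×-zeroSwapping = record
    { _≟_            = λ (a₁ , a₂) (b₁ , b₂) → a₁ σA.≟ b₁ ×-dec a₂ σB.≟ b₂
    ; Z?             = λ (a₁ , a₂) → map′ Z-join (Z-proj A B σA._≟_) (σA.Z? a₁ ⊎-dec σB.Z? a₂)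
    ; 1≉0            = λ 1≈0 → σA.1≉0 (proj₁ 1≈0)
    ; swap           = ×-swap
    ; swap-injective = λ (d₁ , d₂) (a₁ , a₂) (b₁ , b₂) (e₁ , e₂) →
        σA.swap-injective d₁ a₁ b₁ e₁ , σB.swap-injective d₂ a₂ b₂ e₂
    ; swap≈d⇒≈0      = λ (d₁ , d₂) (a₁ , a₂) (e₁ , e₂) → σA.swap≈d⇒≈0 d₁ a₁ e₁ , σB.swap≈d⇒≈0 d₂ a₂ e₂
    ; Z[a]⇒Z[d-swap]    = λ (d₁ , d₂) (a₁ , a₂) Za →
        Z-join (Sum.map (σA.Z[a]⇒Z[d-swap] d₁ a₁) (σB.Z[a]⇒Z[d-swap] d₂ a₂) (Z-proj A B σA._≟_ Za))
    ; Z[swap]⇒Z[d-a]  = λ (d₁ , d₂) (a₁ , a₂) Zσa →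
        Z-join (Sum.map (σA.Z[swap]⇒Z[d-a] d₁ a₁) (σB.Z[swap]⇒Z[d-a] d₂ a₂) (Z-proj A B σA._≟_ Zσa))
    ; ¬Z[d-a]⇒Z[swap-a]     = ×-¬Z[d-a]⇒Z[swap-a]
    }

Prod-1≉0 : ∀ m (F : Fin (suc m) → CommutativeRing c ℓ) → IsField (F Fin.zero) →
           ¬ CommutativeRing._≈_ (Prod m F) (CommutativeRing.1# (Prod m F)) (CommutativeRing.0# (Prod m F))
Prod-1≉0 zero    F F₀-field = IsField.1≉0 F₀-field
Prod-1≉0 (suc m) F F₀-field = λ 1≈0 → IsField.1≉0 F₀-field (proj₁ 1≈0)

Prod-zeroSwapping : ∀ m (F : Fin (suc m) → CommutativeRing c ℓ) → (∀ i → IsField (F i)) →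
                    Decidable (CommutativeRing._≈_ (Prod m F)) → ZeroSwapping (Prod m F)
Prod-zeroSwapping zero    F fields _≟_ = field-zeroSwapping (fields Fin.zero) _≟_
Prod-zeroSwapping (suc m) F fields _≟_ =
  ×-zeroSwapping (field-zeroSwapping (fields Fin.zero) (≟-proj₁ A B _≟_))
                 (Prod-zeroSwapping m (λ i → F (Fin.suc i)) (λ i → fields (Fin.suc i)) (≟-proj₂ A B _≟_))
  where
  A = F Fin.zero
  B = Prod m (λ i → F (Fin.suc i))

m<n∸1⇒1+m<n : ∀ {m} n → m < n ∸ 1 → suc m < n
m<n∸1⇒1+m<n (suc n) m<n = s≤s m<n

module _ {R : CommutativeRing c ℓ} (σ : ZeroSwapping R) where
  open CommutativeRing R
  open ZeroSwapping σ
  open SubtractionLemmas R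

  module _ (x y : Carrier) where
    private
      d : Carrier
      d = x - y

    -- The path through a is x, x − a, y if d − a ∈ Z, and x, x − a, x − swap d a, y otherwise.
    InnerVertex : Carrier → Carrier → Set (c ⊔ ℓ)
    InnerVertex a w = Z R a × (w ≈ x - a ⊎ (¬ Z R (d - a) × w ≈ x - swap d a))

    InnerVertex? : ∀ a w → Dec (InnerVertex a w)
    InnerVertex? a w = Z? a ×-dec (w ≟ (x - a) ⊎-dec (¬? (Z? (d - a)) ×-dec w ≟ (x - swap d a)))

    innerVertex-disjoint : ∀ {a b} → ¬ a ≈ b → Disjoint InnerVertex a b
    innerVertex-disjoint a≉b w (_ , inj₁ w≈x-a) (_ , inj₁ w≈x-b) =
      a≉b (x-y≈x-z⇒y≈z x _ _ (trans (sym w≈x-a) w≈x-b))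
    innerVertex-disjoint a≉b w (Za , inj₁ w≈x-a) (_ , inj₂ (¬Z[d-b] , w≈x-σb)) =
      ¬Z[d-b] (Z[swap]⇒Z[d-a] d _ (Z-resp-≈ R (x-y≈x-z⇒y≈z x _ _ (trans (sym w≈x-a) w≈x-σb)) Za))
    innerVertex-disjoint a≉b w (_ , inj₂ (¬Z[d-a] , w≈x-σa)) (Zb , inj₁ w≈x-b) =
      ¬Z[d-a] (Z[swap]⇒Z[d-a] d _ (Z-resp-≈ R (x-y≈x-z⇒y≈z x _ _ (trans (sym w≈x-b) w≈x-σa)) Zb))
    innerVertex-disjoint a≉b w (_ , inj₂ (_ , w≈x-σa)) (_ , inj₂ (_ , w≈x-σb)) =
      a≉b (swap-injective d _ _ (x-y≈x-z⇒y≈z x _ _ (trans (sym w≈x-σa) w≈x-σb)))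

    detour : ∀ {S a} → ¬ Z R d → Z R a → ¬ Any (InnerVertex a) (x ∷ S) → ¬ _∈ₗ_ setoid y S →
             Walk (CAY R) S x y
    detour {S} {a} ¬Zd Za a-avoids y∉S = detour-by (Z? (d - a))
      where
      avoids : ∀ {w} → w ≈ x - a ⊎ (¬ Z R (d - a) × w ≈ x - swap d a) → ¬ _∈ₗ_ setoid w S
      avoids w-inner w∈S = a-avoids (there (Any.map
        (λ w≈s → Za , Sum.map (trans (sym w≈s)) (Product.map₂ (trans (sym w≈s))) w-inner) w∈S))

      a≉0 : ¬ a ≈ 0#
      a≉0 a≈0 = a-avoids (here (Za , inj₁ (sym (trans (+-congˡ (-‿cong a≈0)) (x-0≈x x)))))

      x≉x-a : ¬ x ≈ x - a
      x≉x-a e = a≉0 (x-y≈x-z⇒y≈z x a 0# (trans (sym e) (sym (x-0≈x x))))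

      Z[x-[x-a]] : Z R (x - (x - a))
      Z[x-[x-a]] = Z-resp-≈ R (sym (x-[x-y]≈y x a)) Za

      detour-by : Dec (Z R (d - a)) → Walk (CAY R) S x y
      detour-by (yes Z[d-a]) =
        step (x≉x-a , Z[x-[x-a]]) (avoids (inj₁ refl))
          (step (x-a≉y , Z-resp-≈ R (sym ([x-y]-z≈[x-z]-y x a y)) Z[d-a]) y∉S (here refl))
        where
        x-a≉y : ¬ x - a ≈ y
        x-a≉y e = ¬Zd (Z-resp-≈ R (x-y≈x-z⇒y≈z x a d (trans e (sym (x-[x-y]≈y x y)))) Za)
      detour-by (no ¬Z[d-a]) =
        step (x≉x-a , Z[x-[x-a]]) (avoids (inj₁ refl))
          (step (x-a≉x-σa , Z-resp-≈ R (sym ([x-y]-[x-z]≈z-y x a _)) (¬Z[d-a]⇒Z[swap-a] d a ¬Z[d-a] a≉0))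
            (avoids (inj₂ (¬Z[d-a] , refl)))
            (step (x-σa≉y , Z-resp-≈ R (sym ([x-y]-z≈[x-z]-y x _ y)) (Z[a]⇒Z[d-swap] d a Za))
              y∉S (here refl)))
        where
        x-a≉x-σa : ¬ x - a ≈ x - swap d a
        x-a≉x-σa e = ¬Z[d-a] (Z-resp-≈ R (+-congˡ (-‿cong (sym (x-y≈x-z⇒y≈z x _ _ e))))
                                          (Z[a]⇒Z[d-swap] d a Za))

        x-σa≉y : ¬ x - swap d a ≈ y
        x-σa≉y e = a≉0 (swap≈d⇒≈0 d a (x-y≈x-z⇒y≈z x _ _ (trans e (sym (x-[x-y]≈y x y)))))

  connectedWithout : ∀ {zs} → Distinct setoid zs → All.All (Z R) zs →
                     ∀ S → suc (length S) < length zs → ConnectedWithout (CAY R) S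
  connectedWithout {zs} distinct all-Z S |S|<|zs| x y _ y∉S with x ≟ y | Z? (x - y)
  ... | yes x≈y | _          = here x≈y
  ... | no  x≉y | yes Z[x-y] = step (x≉y , Z[x-y]) y∉S (here refl)
  ... | no  _   | no ¬Z[x-y]
    with a , a∈zs , a-avoids ← pigeonhole (InnerVertex x y) (InnerVertex? x y) zs (x ∷ S) |S|<|zs|
                                 (AllPairs.map (innerVertex-disjoint x y) distinct)
    = detour x y ¬Z[x-y] (All.lookup all-Z a∈zs) a-avoids y∉S

  κ≥∣Z∣∸1 : ∀ {z} → HasSize setoid (Z R) z → κ≥ (CAY R) (z ∸ 1)
  κ≥∣Z∣∸1 (zs , ≡.refl , distinct , all-Z , _) S _ |S|<|zs|∸1 =
    two-∉ setoid _≟_ distinct S |S|+1<|zs| , connectedWithout distinct all-Z S |S|+1<|zs|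
    where |S|+1<|zs| = m<n∸1⇒1+m<n (length zs) |S|<|zs|∸1

mainTheorem12 : {c ℓ : Level} (m : ℕ) (F : Fin (suc (suc m)) → FiniteField c ℓ) (z : ℕ)
    → HasSize (CommutativeRing.setoid (Prod (suc m) (λ i → FiniteField.ring (F i)))) (Z (Prod (suc m) (λ i → FiniteField.ring (F i)))) z
    → κ≥ (CAY (Prod (suc m) (λ i → FiniteField.ring (F i)))) (z ∸ 1)
mainTheorem12 m F z |Z|≡z = κ≥∣Z∣∸1 (Prod-zeroSwapping (suc m) ring isField _≟_) |Z|≡z
  where
  ring = λ i → FiniteField.ring (F i)
  isField = λ i → FiniteField.isField (F i)
  _≟_ = ≟-from-Z (ring Fin.zero) (Prod m (λ i → ring (Fin.suc i)))
          (IsField.1≉0 (isField Fin.zero)) (Prod-1≉0 m _ (isField (Fin.suc Fin.zero))) |Z|≡z
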